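{- Consider $2\times2\times2\times2$ arrays with entries in $\mathbb{F}_2$. The maximum rank of such an array is $6$, and the numbers of arrays of rank $0,1,2,3,4,5,6$ are $1, 81, 2268, 21744, 37530, 3888, 24$ respectively.
   Context: The rank of a $2\times2\times2\times2$ array $X=(x_{i_1i_2i_3i_4})$ over $\mathbb{F}_2$ is the least $R$ such that $X=\sum_{r=1}^R V_1^{(r)}\otimes V_2^{(r)}\otimes V_3^{(r)}\otimes V_4^{(r)}$ (entrywise addition in $\mathbb{F}_2$), where the $V_j^{(r)}$ are nonzero vectors in $\mathbb{F}_2^2$ and the outer product has entries $v_{1i_1}v_{2i_2}v_{3i_3}v_{4i_4}$. -}

module Defs where

open import Data.Bool using (Bool; true; false; _∧_; _xor_)
open import Data.Nat using (ℕ; zero; suc; _<_; _≤_)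
open import Data.Fin using (Fin)
open import Data.Vec using (Vec; lookup; tabulate)
open import Data.List using (List; []; _∷_; length)
open import Data.Product using (_×_; Σ; ∃; _,_)
open import Relation.Binary.PropositionalEquality using (_≡_)
open import Relation.Nullary using (¬_)

-- F₂ is modelled by Bool: addition = xor, multiplication = ∧.
F2 : Set
F2 = Bool

Vec2 : Set
Vec2 = Vec F2 2

NonZero2 : Vec2 → Set
NonZero2 v = ¬ (∀ i → lookup v i ≡ false)

-- A 2×2×2×2 array over F₂ (nested vectors, so ≡ is extensional).
Tensor : Set
Tensor = Vec (Vec (Vec (Vec F2 2) 2) 2) 2

entry : Tensor → Fin 2 → Fin 2 → Fin 2 → Fin 2 → F2
entry X i j k l = lookup (lookup (lookup (lookup X i) j) k) l

build : (Fin 2 → Fin 2 → Fin 2 → Fin 2 → F2) → Tensor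
build f = tabulate λ i → tabulate λ j → tabulate λ k → tabulate λ l → f i j k l

record RankOne : Set where
  constructor r1
  field
    v₁ v₂ v₃ v₄ : Vec2
    nz₁ : NonZero2 v₁
    nz₂ : NonZero2 v₂
    nz₃ : NonZero2 v₃
    nz₄ : NonZero2 v₄

outer : RankOne → Tensor
outer (r1 a b c d _ _ _ _) =
  build λ i j k l → lookup a i ∧ (lookup b j ∧ (lookup c k ∧ lookup d l))

zeroT : Tensor
zeroT = build λ _ _ _ _ → false

_⊕_ : Tensor → Tensor → Tensor
X ⊕ Y = build λ i j k l → entry X i j k l xor entry Y i j k l

sumT : List RankOne → Tensor
sumT [] = zeroT
sumT (t ∷ ts) = outer t ⊕ sumT ts

HasDecomp : Tensor → ℕ → Set
HasDecomp X R = Σ (List RankOne) λ ts → (length ts ≡ R) × (sumT ts ≡ X)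

IsRank : Tensor → ℕ → Set
IsRank X R = HasDecomp X R × (∀ S → S < R → ¬ HasDecomp X S)

module Submission where

-- A tensor of order n over F₂ is an element of the group (F₂^{2^n}, ⊹), and its rank is its
-- word length with respect to the pure tensors v₁ ⊗ ⋯ ⊗ vₙ (vᵢ ≠ 0).  For a cost table W,
-- the distance transform (D W)(X) = min over lists ts of pure tensors of |ts| + W(X ⊹ Σ ts)
-- is computed by recursion on n: a pure tensor of order n+1 is e ⊗ P with e one of
-- (1,0), (0,1), (1,1), and since the group is abelian the transform for all of them is the
-- composite of the transforms along each e (IsDistance, distance-isDistance).  Tables are
-- stored as tries, and the transform works for any costs with pointwise min and +1, so the
-- order-n transform also serves for tables of tables.  Applied to the table that is 0 at 0
-- and ∞ elsewhere it yields the rank of order-3 tensors (rank₃); the rank of order-4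
-- tensors (rank₄) is one more transform, along (1,0), of rank₃ Y + rank₃ (Y ⊹ Z), because
-- once the (1,0)-part of a decomposition is fixed, the (0,1)- and (1,1)-parts are optimal
-- decompositions of order-3 tensors.  After relating pure tensors and sums to Defs
-- (isRank⇔), the theorem follows by evaluating the rank table of all 2^16 tensors (census)
-- and counting over an explicit enumeration of the tensors.

open import Defs
open import Data.Bool using (Bool; true; false; not; _∧_; _xor_; if_then_else_; T)
open import Data.Bool.Properties using (T-∧; T-≡)
open import Data.Empty using (⊥-elim)
open import Data.Fin using (Fin; toℕ; zero; suc)
open import Data.List using (List; []; _∷_; length; map; filter; cartesianProductWith; _++_)
open import Data.List.Membership.Propositional using (_∈_)
open import Data.List.Membership.Propositional.Properties using (∈-filter⁺; ∈-filter⁻; ∈-cartesianProductWith⁺)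
open import Data.List.Properties using (length-map; length-++; map-++; map-cong; map-∘)
open import Data.List.Relation.Unary.Any using (here; there)
open import Data.List.Relation.Unary.All using ([]; _∷_)
open import Data.List.Relation.Unary.AllPairs using ([]; _∷_)
open import Data.List.Relation.Unary.Unique.Propositional using (Unique)
open import Data.List.Relation.Unary.Unique.Propositional.Properties using (filter⁺; cartesianProductWith⁺)
open import Data.Nat using (ℕ; zero; suc; _+_; _≤_; _<_; _⊓_; _≟_; _<?_; _≤ᵇ_; _≡ᵇ_; z≤n; s≤s)
open import Data.Nat.Properties
open import Data.Nat.ListAction using (sum)
open import Data.Nat.ListAction.Properties using (sum-++)
open import Data.Product using (Σ; _×_; _,_; proj₁; proj₂)
open import Data.Sum using (_⊎_; inj₁; inj₂)
open import Data.Unit using (⊤; tt)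
open import Data.Vec using (Vec; _∷_; []; lookup; tabulate; head)
open import Data.Vec.Properties using (lookup∘tabulate)
open import Function.Bundles using (_⇔_; mk⇔; Equivalence)
open import Relation.Binary.PropositionalEquality
open import Relation.Nullary using (¬_; does; Dec)
open import Relation.Nullary.Decidable using (toWitness)

-- Tensors of order n over F₂ (shape 2 × ⋯ × 2) as nested pairs; Ten 4 is Defs.Tensor.
Ten : ℕ → Set
Ten zero = Bool
Ten (suc n) = Vec (Ten n) 2

pair : ∀ {n} → Ten n → Ten n → Ten (suc n)
pair x y = x ∷ y ∷ []

infixl 6 _⊹_

_⊹_ : ∀ {n} → Ten n → Ten n → Ten n
_⊹_ {zero} a b = a xor b
_⊹_ {suc n} (a ∷ b ∷ []) (c ∷ d ∷ []) = (a ⊹ c) ∷ (b ⊹ d) ∷ []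

0ᵗ : ∀ {n} → Ten n
0ᵗ {zero} = false
0ᵗ {suc n} = 0ᵗ ∷ 0ᵗ ∷ []

⊹-identityˡ : ∀ {n} (x : Ten n) → 0ᵗ ⊹ x ≡ x
⊹-identityˡ {zero} x = refl
⊹-identityˡ {suc n} (a ∷ b ∷ []) = cong₂ pair (⊹-identityˡ a) (⊹-identityˡ b)

⊹-identityʳ : ∀ {n} (x : Ten n) → x ⊹ 0ᵗ ≡ x
⊹-identityʳ {zero} false = refl
⊹-identityʳ {zero} true = refl
⊹-identityʳ {suc n} (a ∷ b ∷ []) = cong₂ pair (⊹-identityʳ a) (⊹-identityʳ b)

⊹-self : ∀ {n} (x : Ten n) → x ⊹ x ≡ 0ᵗ
⊹-self {zero} false = refl
⊹-self {zero} true = refl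
⊹-self {suc n} (a ∷ b ∷ []) = cong₂ pair (⊹-self a) (⊹-self b)

⊹-assoc : ∀ {n} (x y z : Ten n) → (x ⊹ y) ⊹ z ≡ x ⊹ (y ⊹ z)
⊹-assoc {zero} false y z = refl
⊹-assoc {zero} true false z = refl
⊹-assoc {zero} true true false = refl
⊹-assoc {zero} true true true = refl
⊹-assoc {suc n} (a ∷ b ∷ []) (c ∷ d ∷ []) (e ∷ f ∷ []) = cong₂ pair (⊹-assoc a c e) (⊹-assoc b d f)

⊹-comm : ∀ {n} (x y : Ten n) → x ⊹ y ≡ y ⊹ x
⊹-comm {zero} false false = refl
⊹-comm {zero} false true = refl
⊹-comm {zero} true false = refl
⊹-comm {zero} true true = refl
⊹-comm {suc n} (a ∷ b ∷ []) (c ∷ d ∷ []) = cong₂ pair (⊹-comm a c) (⊹-comm b d)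

⊹-cancelˡ : ∀ {n} (x y : Ten n) → x ⊹ (x ⊹ y) ≡ y
⊹-cancelˡ x y = trans (sym (⊹-assoc x x y)) (trans (cong (_⊹ y) (⊹-self x)) (⊹-identityˡ y))

⊹-cancel-outer : ∀ {n} (x y : Ten n) → x ⊹ (y ⊹ x) ≡ y
⊹-cancel-outer x y = trans (cong (x ⊹_) (⊹-comm y x)) (⊹-cancelˡ x y)

⊹-cancel-wrap : ∀ {n} (x y : Ten n) → (x ⊹ y) ⊹ x ≡ y
⊹-cancel-wrap x y = trans (⊹-comm (x ⊹ y) x) (⊹-cancelˡ x y)

⊹-zero⇒≡ : ∀ {n} (x y : Ten n) → x ⊹ y ≡ 0ᵗ → y ≡ x
⊹-zero⇒≡ x y e = trans (sym (⊹-cancelˡ x y)) (trans (cong (x ⊹_) e) (⊹-identityʳ x))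

⊹-swap : ∀ {n} (x y z : Ten n) → x ⊹ (y ⊹ z) ≡ y ⊹ (x ⊹ z)
⊹-swap x y z = trans (sym (⊹-assoc x y z)) (trans (cong (_⊹ z) (⊹-comm x y)) (⊹-assoc y x z))

⊹-cancelᵐ : ∀ {n} (x s y : Ten n) → (x ⊹ s) ⊹ (x ⊹ y) ≡ y ⊹ s
⊹-cancelᵐ x s y = begin
  (x ⊹ s) ⊹ (x ⊹ y) ≡⟨ cong (_⊹ (x ⊹ y)) (⊹-comm x s) ⟩
  (s ⊹ x) ⊹ (x ⊹ y) ≡⟨ ⊹-assoc s x (x ⊹ y) ⟩
  s ⊹ (x ⊹ (x ⊹ y)) ≡⟨ cong (s ⊹_) (⊹-cancelˡ x y) ⟩
  s ⊹ y             ≡⟨ ⊹-comm s y ⟩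
  y ⊹ s             ∎
  where open ≡-Reasoning

-- The three nonzero vectors (1,0), (0,1), (1,1) of F₂².
data Dir : Set where
  e₀ e₁ e₀₁ : Dir

Pure : ℕ → Set
Pure zero = ⊤
Pure (suc n) = Dir × Pure n

infixr 7 _⊗_

_⊗_ : ∀ {n} → Dir → Ten n → Ten (suc n)
e₀ ⊗ t = t ∷ 0ᵗ ∷ []
e₁ ⊗ t = 0ᵗ ∷ t ∷ []
e₀₁ ⊗ t = t ∷ t ∷ []

⊗-linear : ∀ {n} d (x y : Ten n) → d ⊗ x ⊹ d ⊗ y ≡ d ⊗ (x ⊹ y)
⊗-linear e₀ x y = cong (pair (x ⊹ y)) (⊹-identityˡ 0ᵗ)
⊗-linear e₁ x y = cong (λ z → pair z (x ⊹ y)) (⊹-identityˡ 0ᵗ)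
⊗-linear e₀₁ x y = refl

prefix : ∀ {n} → Dir → Pure n → Pure (suc n)
prefix d p = d , p

⟦_⟧ : ∀ {n} → Pure n → Ten n
⟦_⟧ {zero} _ = true
⟦_⟧ {suc n} (d , p) = d ⊗ ⟦ p ⟧

sumᴾ : ∀ {n} → List (Pure n) → Ten n
sumᴾ [] = 0ᵗ
sumᴾ (p ∷ ps) = ⟦ p ⟧ ⊹ sumᴾ ps

sumᴾ-++ : ∀ {n} (ps qs : List (Pure n)) → sumᴾ (ps ++ qs) ≡ sumᴾ ps ⊹ sumᴾ qs
sumᴾ-++ [] qs = sym (⊹-identityˡ (sumᴾ qs))
sumᴾ-++ (p ∷ ps) qs = trans (cong (⟦ p ⟧ ⊹_) (sumᴾ-++ ps qs)) (sym (⊹-assoc ⟦ p ⟧ (sumᴾ ps) (sumᴾ qs)))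

sumᴾ-⊗ : ∀ {n} d (ps : List (Pure n)) → sumᴾ (map (prefix d) ps) ≡ d ⊗ sumᴾ ps
sumᴾ-⊗ d [] = sym (⊗-zero d)
  where
  ⊗-zero : ∀ d → d ⊗ 0ᵗ ≡ 0ᵗ
  ⊗-zero e₀ = refl
  ⊗-zero e₁ = refl
  ⊗-zero e₀₁ = refl
sumᴾ-⊗ d (p ∷ ps) = trans (cong (d ⊗ ⟦ p ⟧ ⊹_) (sumᴾ-⊗ d ps)) (⊗-linear d ⟦ p ⟧ (sumᴾ ps))

record ByFirstFactor {n} (ps : List (Pure (suc n))) : Set where
  constructor sorted
  field
    part₀ part₁ part₀₁ : List (Pure n)
    length-≡ : length ps ≡ length part₀ + (length part₁ + length part₀₁)
    sum-≡ : sumᴾ ps ≡ e₀ ⊗ sumᴾ part₀ ⊹ (e₁ ⊗ sumᴾ part₁ ⊹ e₀₁ ⊗ sumᴾ part₀₁)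

byFirstFactor : ∀ {n} (ps : List (Pure (suc n))) → ByFirstFactor ps
byFirstFactor [] = sorted [] [] [] refl (sym (trans (⊹-identityˡ _) (⊹-identityˡ 0ᵗ)))
byFirstFactor {n} ((e₀ , p) ∷ ps) with byFirstFactor ps
... | sorted a b c l s = sorted (p ∷ a) b c (cong suc l) (begin
      e₀ ⊗ ⟦ p ⟧ ⊹ sumᴾ ps
        ≡⟨ cong (e₀ ⊗ ⟦ p ⟧ ⊹_) s ⟩
      e₀ ⊗ ⟦ p ⟧ ⊹ (e₀ ⊗ sumᴾ a ⊹ R)
        ≡⟨ sym (⊹-assoc (e₀ ⊗ ⟦ p ⟧) (e₀ ⊗ sumᴾ a) R) ⟩
      e₀ ⊗ ⟦ p ⟧ ⊹ e₀ ⊗ sumᴾ a ⊹ R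
        ≡⟨ cong (_⊹ R) (⊗-linear e₀ ⟦ p ⟧ (sumᴾ a)) ⟩
      e₀ ⊗ (⟦ p ⟧ ⊹ sumᴾ a) ⊹ R ∎)
  where
  open ≡-Reasoning
  R : Ten (suc n)
  R = e₁ ⊗ sumᴾ b ⊹ e₀₁ ⊗ sumᴾ c
byFirstFactor ((e₁ , p) ∷ ps) with byFirstFactor ps
... | sorted a b c l s = sorted a (p ∷ b) c
      (trans (cong suc l) (sym (+-suc (length a) _))) (begin
      e₁ ⊗ ⟦ p ⟧ ⊹ sumᴾ ps
        ≡⟨ cong (e₁ ⊗ ⟦ p ⟧ ⊹_) s ⟩
      e₁ ⊗ ⟦ p ⟧ ⊹ (e₀ ⊗ sumᴾ a ⊹ (e₁ ⊗ sumᴾ b ⊹ e₀₁ ⊗ sumᴾ c))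
        ≡⟨ ⊹-swap (e₁ ⊗ ⟦ p ⟧) (e₀ ⊗ sumᴾ a) (e₁ ⊗ sumᴾ b ⊹ e₀₁ ⊗ sumᴾ c) ⟩
      e₀ ⊗ sumᴾ a ⊹ (e₁ ⊗ ⟦ p ⟧ ⊹ (e₁ ⊗ sumᴾ b ⊹ e₀₁ ⊗ sumᴾ c))
        ≡⟨ cong (e₀ ⊗ sumᴾ a ⊹_) (sym (⊹-assoc (e₁ ⊗ ⟦ p ⟧) (e₁ ⊗ sumᴾ b) (e₀₁ ⊗ sumᴾ c))) ⟩
      e₀ ⊗ sumᴾ a ⊹ (e₁ ⊗ ⟦ p ⟧ ⊹ e₁ ⊗ sumᴾ b ⊹ e₀₁ ⊗ sumᴾ c)
        ≡⟨ cong (λ z → e₀ ⊗ sumᴾ a ⊹ (z ⊹ e₀₁ ⊗ sumᴾ c)) (⊗-linear e₁ ⟦ p ⟧ (sumᴾ b)) ⟩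
      e₀ ⊗ sumᴾ a ⊹ (e₁ ⊗ (⟦ p ⟧ ⊹ sumᴾ b) ⊹ e₀₁ ⊗ sumᴾ c) ∎)
  where open ≡-Reasoning
byFirstFactor ((e₀₁ , p) ∷ ps) with byFirstFactor ps
... | sorted a b c l s = sorted a b (p ∷ c)
      (trans (cong suc l) (sym (trans (cong (length a +_) (+-suc (length b) _)) (+-suc (length a) _)))) (begin
      e₀₁ ⊗ ⟦ p ⟧ ⊹ sumᴾ ps
        ≡⟨ cong (e₀₁ ⊗ ⟦ p ⟧ ⊹_) s ⟩
      e₀₁ ⊗ ⟦ p ⟧ ⊹ (e₀ ⊗ sumᴾ a ⊹ (e₁ ⊗ sumᴾ b ⊹ e₀₁ ⊗ sumᴾ c))
        ≡⟨ ⊹-swap (e₀₁ ⊗ ⟦ p ⟧) (e₀ ⊗ sumᴾ a) (e₁ ⊗ sumᴾ b ⊹ e₀₁ ⊗ sumᴾ c) ⟩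
      e₀ ⊗ sumᴾ a ⊹ (e₀₁ ⊗ ⟦ p ⟧ ⊹ (e₁ ⊗ sumᴾ b ⊹ e₀₁ ⊗ sumᴾ c))
        ≡⟨ cong (e₀ ⊗ sumᴾ a ⊹_) (⊹-swap (e₀₁ ⊗ ⟦ p ⟧) (e₁ ⊗ sumᴾ b) (e₀₁ ⊗ sumᴾ c)) ⟩
      e₀ ⊗ sumᴾ a ⊹ (e₁ ⊗ sumᴾ b ⊹ (e₀₁ ⊗ ⟦ p ⟧ ⊹ e₀₁ ⊗ sumᴾ c)) ∎)
  where open ≡-Reasoning

joinFactors : ∀ {n} → List (Pure n) → List (Pure n) → List (Pure n) → List (Pure (suc n))
joinFactors a b c = map (prefix e₀) a ++ (map (prefix e₁) b ++ map (prefix e₀₁) c)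

length-joinFactors : ∀ {n} (a b c : List (Pure n)) →
  length (joinFactors a b c) ≡ length a + (length b + length c)
length-joinFactors a b c = trans (length-++ (map (prefix e₀) a))
  (cong₂ _+_ (length-map (prefix e₀) a)
    (trans (length-++ (map (prefix e₁) b)) (cong₂ _+_ (length-map (prefix e₁) b) (length-map (prefix e₀₁) c))))

sumᴾ-joinFactors : ∀ {n} (a b c : List (Pure n)) →
  sumᴾ (joinFactors a b c) ≡ e₀ ⊗ sumᴾ a ⊹ (e₁ ⊗ sumᴾ b ⊹ e₀₁ ⊗ sumᴾ c)
sumᴾ-joinFactors a b c = trans (sumᴾ-++ (map (prefix e₀) a) _)
  (cong₂ _⊹_ (sumᴾ-⊗ e₀ a) (trans (sumᴾ-++ (map (prefix e₁) b) _) (cong₂ _⊹_ (sumᴾ-⊗ e₁ b) (sumᴾ-⊗ e₀₁ c))))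

infixr 4 _&_

data Both (A : Set) : Set where
  _&_ : A → A → Both A

-- Table n A stores a function Ten n → A as a trie, so that it can be evaluated once.
Table : ℕ → Set → Set
Table zero A = Both A
Table (suc n) A = Table n (Table n A)

at : ∀ n {A : Set} → Table n A → Ten n → A
at zero (a & b) false = a
at zero (a & b) true = b
at (suc n) t (x ∷ y ∷ []) = at n (at n t x) y

mapᵀ : ∀ n {A B : Set} → (A → B) → Table n A → Table n B
mapᵀ zero f (a & b) = f a & f b
mapᵀ (suc n) f t = mapᵀ n (mapᵀ n f) t

zipᵀ : ∀ n {A B C : Set} → (A → B → C) → Table n A → Table n B → Table n C
zipᵀ zero f (a & b) (c & d) = f a c & f b d
zipᵀ (suc n) f t u = zipᵀ n (zipᵀ n f) t u

tableOf : ∀ n {A : Set} → (Ten n → A) → Table n A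
tableOf zero f = f false & f true
tableOf (suc n) f = tableOf n (λ x → tableOf n (λ y → f (x ∷ y ∷ [])))

translate : ∀ n {A : Set} → Ten n → Table n A → Table n A
translate zero false t = t
translate zero true (a & b) = b & a
translate (suc n) (x ∷ y ∷ []) t = translate n x (mapᵀ n (translate n y) t)

mapWithIndex : ∀ n {A B : Set} → (Ten n → A → B) → Table n A → Table n B
mapWithIndex zero f (a & b) = f false a & f true b
mapWithIndex (suc n) f t = mapWithIndex n (λ x u → mapWithIndex n (λ y a → f (x ∷ y ∷ []) a) u) t

at-mapᵀ : ∀ n {A B : Set} (f : A → B) t X → at n (mapᵀ n f t) X ≡ f (at n t X)
at-mapᵀ zero f (a & b) false = refl
at-mapᵀ zero f (a & b) true = refl
at-mapᵀ (suc n) f t (x ∷ y ∷ []) rewrite at-mapᵀ n (mapᵀ n f) t x = at-mapᵀ n f (at n t x) y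

at-zipᵀ : ∀ n {A B C : Set} (f : A → B → C) t u X → at n (zipᵀ n f t u) X ≡ f (at n t X) (at n u X)
at-zipᵀ zero f (a & b) (c & d) false = refl
at-zipᵀ zero f (a & b) (c & d) true = refl
at-zipᵀ (suc n) f t u (x ∷ y ∷ []) rewrite at-zipᵀ n (zipᵀ n f) t u x = at-zipᵀ n f (at n t x) (at n u x) y

at-tableOf : ∀ n {A : Set} (f : Ten n → A) X → at n (tableOf n f) X ≡ f X
at-tableOf zero f false = refl
at-tableOf zero f true = refl
at-tableOf (suc n) f (x ∷ y ∷ [])
  rewrite at-tableOf n (λ x → tableOf n (λ y → f (x ∷ y ∷ []))) x = at-tableOf n (λ y → f (x ∷ y ∷ [])) y

at-translate : ∀ n {A : Set} (x : Ten n) (t : Table n A) y → at n (translate n x t) y ≡ at n t (x ⊹ y)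
at-translate zero false t y = refl
at-translate zero true (a & b) false = refl
at-translate zero true (a & b) true = refl
at-translate (suc n) (x ∷ y ∷ []) t (u ∷ v ∷ [])
  rewrite at-translate n x (mapᵀ n (translate n y) t) u
        | at-mapᵀ n (translate n y) t (x ⊹ u) = at-translate n y (at n t (x ⊹ u)) v

at-mapWithIndex : ∀ n {A B : Set} (f : Ten n → A → B) t X → at n (mapWithIndex n f t) X ≡ f X (at n t X)
at-mapWithIndex zero f (a & b) false = refl
at-mapWithIndex zero f (a & b) true = refl
at-mapWithIndex (suc n) f t (x ∷ y ∷ [])
  rewrite at-mapWithIndex n (λ x u → mapWithIndex n (λ y a → f (x ∷ y ∷ []) a) u) t x
  = at-mapWithIndex n (λ y a → f (x ∷ y ∷ []) a) (at n t x) y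

-- shear W is the table of (Y, Z) ↦ W(Y, Y ⊹ Z); it carries e₀ ⊗ _ to e₀₁ ⊗ _.
shear : ∀ n {A : Set} → Table (suc n) A → Table (suc n) A
shear n W = mapWithIndex n (λ x u → translate n x u) W

at-shear : ∀ n {A : Set} (W : Table (suc n) A) Y Z → at (suc n) (shear n W) (pair Y Z) ≡ at (suc n) W (pair Y (Y ⊹ Z))
at-shear n W Y Z = trans (cong (λ w → at n w Z) (at-mapWithIndex n (λ x u → translate n x u) W Y))
  (at-translate n Y (at n W Y) Z)

-- The distance transform for pure tensors of order n, over any (min, +1) structure on A.
-- At order n+1 it is composed of the transforms along e₀ ⊗ _, e₁ ⊗ _ and e₀₁ ⊗ _: the first
-- is the order-n transform applied to tables of tables, the second the order-n transform
-- applied inside each row, and the third the first conjugated by the shear.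
dist : ∀ n {A : Set} → (A → A → A) → (A → A) → Table n A → Table n A
dist₀ dist₁ dist₀₁ : ∀ n {A : Set} → (A → A → A) → (A → A) → Table (suc n) A → Table (suc n) A
dist₀ n mn inc W = dist n (zipᵀ n mn) (mapᵀ n inc) W
dist₁ n mn inc W = mapᵀ n (dist n mn inc) W
dist₀₁ n mn inc W = shear n (dist₀ n mn inc (shear n W))
dist zero mn inc (a & b) = mn a (inc b) & mn b (inc a)
dist (suc n) mn inc W = dist₀ n mn inc (dist₁ n mn inc (dist₀₁ n mn inc W))

-- A type A of Ix-indexed families of naturals, with pointwise minimum and successor.
record Costs : Set₁ where
  field
    A : Set
    Ix : Set
    ev : A → Ix → ℕ
    mn : A → A → A
    inc : A → A
    ev-mn : ∀ a b i → ev (mn a b) i ≡ ev a i ⊓ ev b i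
    ev-inc : ∀ a i → ev (inc a) i ≡ suc (ev a i)

ℕCosts : Costs
ℕCosts = record
  { A = ℕ ; Ix = ⊤ ; ev = λ a _ → a ; mn = _⊓_ ; inc = suc
  ; ev-mn = λ _ _ _ → refl ; ev-inc = λ _ _ → refl }

tableCosts : ℕ → Costs → Costs
tableCosts n M = record
  { A = Table n A
  ; Ix = Ten n × Ix
  ; ev = λ t xi → ev (at n t (proj₁ xi)) (proj₂ xi)
  ; mn = zipᵀ n mn
  ; inc = mapᵀ n inc
  ; ev-mn = λ t u xi → trans (cong (λ z → ev z (proj₂ xi)) (at-zipᵀ n mn t u (proj₁ xi))) (ev-mn _ _ _)
  ; ev-inc = λ t xi → trans (cong (λ z → ev z (proj₂ xi)) (at-mapᵀ n inc t (proj₁ xi))) (ev-inc _ _)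
  }
  where open Costs M

record Transformer (n : ℕ) : Set₁ where
  constructor transformer
  field
    run : ∀ {A : Set} → (A → A → A) → (A → A) → Table n A → Table n A

distance : ∀ n → Transformer n
distance n = transformer (dist n)

along₀ along₁ along₀₁ : ∀ n → Transformer (suc n)
along₀ n = transformer (dist₀ n)
along₁ n = transformer (dist₁ n)
along₀₁ n = transformer (dist₀₁ n)

apply : ∀ {n} → Transformer n → (M : Costs) → Table n (Costs.A M) → Table n (Costs.A M)
apply K M = Transformer.run K (Costs.mn M) (Costs.inc M)

cost : ∀ {n} (M : Costs) → Table n (Costs.A M) → Ten n → Costs.Ix M → ℕ
cost {n} M W X i = Costs.ev M (at n W X) i

record IsDistance {G : Set} {n} (σ : List G → Ten n) (K : Transformer n) : Set₁ where
  field
    bounded : ∀ M (W : Table n (Costs.A M)) X i ts → cost M (apply K M W) X i ≤ length ts + cost M W (X ⊹ σ ts) i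
    attained : ∀ M (W : Table n (Costs.A M)) X i → Σ (List G) λ ts → cost M (apply K M W) X i ≡ length ts + cost M W (X ⊹ σ ts) i

-- The only pure tensor of order 0 is 1, so a list of them sums to its parity.
parityᴾ : (ps : List (Pure 0)) → (sumᴾ ps ≡ false) ⊎ (sumᴾ ps ≡ true × 1 ≤ length ps)
parityᴾ [] = inj₁ refl
parityᴾ (tt ∷ ps) with parityᴾ ps
... | inj₁ e rewrite e = inj₂ (refl , s≤s z≤n)
... | inj₂ (e , _) rewrite e = inj₁ refl

cost-distance-zero : ∀ M (W : Table 0 (Costs.A M)) X i →
  cost M (apply (distance 0) M W) X i ≡ cost M W X i ⊓ suc (cost M W (X ⊹ true) i)
cost-distance-zero M (a & b) false i = trans (Costs.ev-mn M a _ i) (cong (Costs.ev M a i ⊓_) (Costs.ev-inc M b i))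
cost-distance-zero M (a & b) true i = trans (Costs.ev-mn M b _ i) (cong (Costs.ev M b i ⊓_) (Costs.ev-inc M a i))


distance-zero : IsDistance sumᴾ (distance 0)
distance-zero = record { bounded = bounded ; attained = attained }
  where
  bounded : ∀ M (W : Table 0 (Costs.A M)) X i ps → cost M (apply (distance 0) M W) X i ≤ length ps + cost M W (X ⊹ sumᴾ ps) i
  bounded M W X i ps rewrite cost-distance-zero M W X i with parityᴾ ps
  ... | inj₁ e rewrite e | ⊹-identityʳ X = ≤-trans (m⊓n≤m _ _) (m≤n+m _ (length ps))
  ... | inj₂ (e , l) rewrite e = ≤-trans (m⊓n≤n _ _) (+-monoˡ-≤ _ l)
  attained : ∀ M (W : Table 0 (Costs.A M)) X i → Σ (List (Pure 0)) λ ps →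
    cost M (apply (distance 0) M W) X i ≡ length ps + cost M W (X ⊹ sumᴾ ps) i
  attained M W X i with ⊓-sel (cost M W X i) (suc (cost M W (X ⊹ true) i))
  ... | inj₁ e = [] , trans (cost-distance-zero M W X i) (trans e (cong (λ Y → cost M W Y i) (sym (⊹-identityʳ X))))
  ... | inj₂ e = (tt ∷ []) , trans (cost-distance-zero M W X i) e

along₀-isDistance : ∀ {n} → IsDistance sumᴾ (distance n) → IsDistance (λ ps → e₀ ⊗ sumᴾ ps) (along₀ n)
along₀-isDistance {n} D = record { bounded = bounded ; attained = attained }
  where
  open IsDistance D renaming (bounded to boundedₙ; attained to attainedₙ)
  shifted : ∀ M (W : Table (suc n) (Costs.A M)) X0 X1 S i →
    cost (tableCosts n M) W (X0 ⊹ S) (X1 , i) ≡ cost M W (pair X0 X1 ⊹ e₀ ⊗ S) i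
  shifted M W X0 X1 S i = cong (λ Z → cost M W (pair (X0 ⊹ S) Z) i) (sym (⊹-identityʳ X1))
  bounded : ∀ M (W : Table (suc n) (Costs.A M)) X i ps →
    cost M (apply (along₀ n) M W) X i ≤ length ps + cost M W (X ⊹ e₀ ⊗ sumᴾ ps) i
  bounded M W (X0 ∷ X1 ∷ []) i ps = subst (λ c → cost M (apply (along₀ n) M W) (pair X0 X1) i ≤ length ps + c) (shifted M W X0 X1 (sumᴾ ps) i)
    (boundedₙ (tableCosts n M) W X0 (X1 , i) ps)
  attained : ∀ M (W : Table (suc n) (Costs.A M)) X i → Σ (List (Pure n)) λ ps →
    cost M (apply (along₀ n) M W) X i ≡ length ps + cost M W (X ⊹ e₀ ⊗ sumᴾ ps) i
  attained M W (X0 ∷ X1 ∷ []) i with attainedₙ (tableCosts n M) W X0 (X1 , i)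
  ... | ps , e = ps , trans e (cong (length ps +_) (shifted M W X0 X1 (sumᴾ ps) i))

along₁-isDistance : ∀ {n} → IsDistance sumᴾ (distance n) → IsDistance (λ ps → e₁ ⊗ sumᴾ ps) (along₁ n)
along₁-isDistance {n} D = record { bounded = bounded ; attained = attained }
  where
  open IsDistance D renaming (bounded to boundedₙ; attained to attainedₙ)
  inside : ∀ M (W : Table (suc n) (Costs.A M)) X0 X1 i →
    cost M (apply (along₁ n) M W) (pair X0 X1) i ≡ cost M (apply (distance n) M (at n W X0)) X1 i
  inside M W X0 X1 i = cong (λ t → Costs.ev M (at n t X1) i) (at-mapᵀ n (apply (distance n) M) W X0)
  shifted : ∀ M (W : Table (suc n) (Costs.A M)) X0 X1 S i →
    cost M (at n W X0) (X1 ⊹ S) i ≡ cost M W (pair X0 X1 ⊹ e₁ ⊗ S) i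
  shifted M W X0 X1 S i = cong (λ Y → cost M W (pair Y (X1 ⊹ S)) i) (sym (⊹-identityʳ X0))
  bounded : ∀ M (W : Table (suc n) (Costs.A M)) X i ps →
    cost M (apply (along₁ n) M W) X i ≤ length ps + cost M W (X ⊹ e₁ ⊗ sumᴾ ps) i
  bounded M W (X0 ∷ X1 ∷ []) i ps = begin
    cost M (apply (along₁ n) M W) (pair X0 X1) i     ≡⟨ inside M W X0 X1 i ⟩
    cost M (apply (distance n) M (at n W X0)) X1 i   ≤⟨ boundedₙ M (at n W X0) X1 i ps ⟩
    length ps + cost M (at n W X0) (X1 ⊹ sumᴾ ps) i  ≡⟨ cong (length ps +_) (shifted M W X0 X1 (sumᴾ ps) i) ⟩
    length ps + cost M W (pair X0 X1 ⊹ e₁ ⊗ sumᴾ ps) i ∎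
    where open ≤-Reasoning
  attained : ∀ M (W : Table (suc n) (Costs.A M)) X i → Σ (List (Pure n)) λ ps →
    cost M (apply (along₁ n) M W) X i ≡ length ps + cost M W (X ⊹ e₁ ⊗ sumᴾ ps) i
  attained M W (X0 ∷ X1 ∷ []) i with attainedₙ M (at n W X0) X1 i
  ... | ps , e = ps , trans (inside M W X0 X1 i) (trans e (cong (length ps +_) (shifted M W X0 X1 (sumᴾ ps) i)))

along₀₁-isDistance : ∀ {n} → IsDistance (λ ps → e₀ ⊗ sumᴾ ps) (along₀ n) →
  IsDistance (λ ps → e₀₁ ⊗ sumᴾ ps) (along₀₁ n)
along₀₁-isDistance {n} D₀ = record { bounded = bounded ; attained = attained }
  where
  open IsDistance D₀ renaming (bounded to bounded₀; attained to attained₀)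
  sheared : ∀ M (W : Table (suc n) (Costs.A M)) X0 X1 i → cost M (apply (along₀₁ n) M W) (pair X0 X1) i
    ≡ cost M (apply (along₀ n) M (shear n W)) (pair X0 (X0 ⊹ X1)) i
  sheared M W X0 X1 i = cong (λ a → Costs.ev M a i) (at-shear n (apply (along₀ n) M (shear n W)) X0 X1)
  unsheared : ∀ M (W : Table (suc n) (Costs.A M)) X0 X1 S i →
    cost M (shear n W) (pair X0 (X0 ⊹ X1) ⊹ e₀ ⊗ S) i ≡ cost M W (pair X0 X1 ⊹ e₀₁ ⊗ S) i
  unsheared M W X0 X1 S i = trans (cong (λ a → Costs.ev M a i) (at-shear n W (X0 ⊹ S) ((X0 ⊹ X1) ⊹ 0ᵗ)))
    (cong (λ Z → cost M W (pair (X0 ⊹ S) Z) i)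
      (trans (cong ((X0 ⊹ S) ⊹_) (⊹-identityʳ (X0 ⊹ X1))) (⊹-cancelᵐ X0 S X1)))
  bounded : ∀ M (W : Table (suc n) (Costs.A M)) X i ps →
    cost M (apply (along₀₁ n) M W) X i ≤ length ps + cost M W (X ⊹ e₀₁ ⊗ sumᴾ ps) i
  bounded M W (X0 ∷ X1 ∷ []) i ps = begin
    cost M (apply (along₀₁ n) M W) (pair X0 X1) i
      ≡⟨ sheared M W X0 X1 i ⟩
    cost M (apply (along₀ n) M (shear n W)) (pair X0 (X0 ⊹ X1)) i
      ≤⟨ bounded₀ M (shear n W) (pair X0 (X0 ⊹ X1)) i ps ⟩
    length ps + cost M (shear n W) (pair X0 (X0 ⊹ X1) ⊹ e₀ ⊗ sumᴾ ps) i
      ≡⟨ cong (length ps +_) (unsheared M W X0 X1 (sumᴾ ps) i) ⟩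
    length ps + cost M W (pair X0 X1 ⊹ e₀₁ ⊗ sumᴾ ps) i ∎
    where open ≤-Reasoning
  attained : ∀ M (W : Table (suc n) (Costs.A M)) X i → Σ (List (Pure n)) λ ps →
    cost M (apply (along₀₁ n) M W) X i ≡ length ps + cost M W (X ⊹ e₀₁ ⊗ sumᴾ ps) i
  attained M W (X0 ∷ X1 ∷ []) i with attained₀ M (shear n W) (pair X0 (X0 ⊹ X1)) i
  ... | ps , e = ps , trans (sheared M W X0 X1 i) (trans e (cong (length ps +_) (unsheared M W X0 X1 (sumᴾ ps) i)))

-- Every pure tensor of order n+1 is e₀ ⊗ P, e₁ ⊗ P or e₀₁ ⊗ P, so the composite of the
-- three transforms is the distance transform for all pure tensors of order n+1.
distance-suc : ∀ {n} → IsDistance sumᴾ (distance n) → IsDistance sumᴾ (distance (suc n))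
distance-suc {n} D = record { bounded = bounded ; attained = attained }
  where
  D₀ : IsDistance (λ ps → e₀ ⊗ sumᴾ ps) (along₀ n)
  D₀ = along₀-isDistance D
  D₁ : IsDistance (λ ps → e₁ ⊗ sumᴾ ps) (along₁ n)
  D₁ = along₁-isDistance D
  D₀₁ : IsDistance (λ ps → e₀₁ ⊗ sumᴾ ps) (along₀₁ n)
  D₀₁ = along₀₁-isDistance D₀
  regroup : ∀ M (W : Table (suc n) (Costs.A M)) X i (a b c : List (Pure n)) →
    let A = e₀ ⊗ sumᴾ a ; B = e₁ ⊗ sumᴾ b ; C = e₀₁ ⊗ sumᴾ c in
    length a + (length b + (length c + cost M W (X ⊹ A ⊹ B ⊹ C) i))
      ≡ (length a + (length b + length c)) + cost M W (X ⊹ (A ⊹ (B ⊹ C))) i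
  regroup M W X i a b c = trans
    (cong (λ Y → length a + (length b + (length c + cost M W Y i)))
      (trans (⊹-assoc (X ⊹ _) _ _) (⊹-assoc X _ _)))
    (sym (trans (+-assoc (length a) _ _) (cong (length a +_) (+-assoc (length b) _ _))))
  bounded : ∀ M (W : Table (suc n) (Costs.A M)) X i ps →
    cost M (apply (distance (suc n)) M W) X i ≤ length ps + cost M W (X ⊹ sumᴾ ps) i
  bounded M W X i ps with byFirstFactor ps
  ... | sorted a b c l s = begin
    cost M (apply (along₀ n) M V) X i
      ≤⟨ IsDistance.bounded D₀ M V X i a ⟩
    length a + cost M V (X ⊹ A) i
      ≤⟨ +-monoʳ-≤ (length a) (IsDistance.bounded D₁ M U (X ⊹ A) i b) ⟩
    length a + (length b + cost M U (X ⊹ A ⊹ B) i)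
      ≤⟨ +-monoʳ-≤ (length a) (+-monoʳ-≤ (length b) (IsDistance.bounded D₀₁ M W (X ⊹ A ⊹ B) i c)) ⟩
    length a + (length b + (length c + cost M W (X ⊹ A ⊹ B ⊹ C) i))
      ≡⟨ regroup M W X i a b c ⟩
    (length a + (length b + length c)) + cost M W (X ⊹ (A ⊹ (B ⊹ C))) i
      ≡⟨ cong₂ (λ ℓ S → ℓ + cost M W (X ⊹ S) i) (sym l) (sym s) ⟩
    length ps + cost M W (X ⊹ sumᴾ ps) i ∎
    where
    open ≤-Reasoning
    U V : Table (suc n) (Costs.A M)
    U = apply (along₀₁ n) M W
    V = apply (along₁ n) M U
    A B C : Ten (suc n)
    A = e₀ ⊗ sumᴾ a
    B = e₁ ⊗ sumᴾ b
    C = e₀₁ ⊗ sumᴾ c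
  attained : ∀ M (W : Table (suc n) (Costs.A M)) X i → Σ (List (Pure (suc n))) λ ps →
    cost M (apply (distance (suc n)) M W) X i ≡ length ps + cost M W (X ⊹ sumᴾ ps) i
  attained M W X i
    with IsDistance.attained D₀ M (apply (along₁ n) M (apply (along₀₁ n) M W)) X i
  ... | a , ea
    with IsDistance.attained D₁ M (apply (along₀₁ n) M W) (X ⊹ e₀ ⊗ sumᴾ a) i
  ... | b , eb
    with IsDistance.attained D₀₁ M W (X ⊹ e₀ ⊗ sumᴾ a ⊹ e₁ ⊗ sumᴾ b) i
  ... | c , ec = joinFactors a b c , (begin
    cost M (apply (distance (suc n)) M W) X i
      ≡⟨ ea ⟩
    length a + cost M V (X ⊹ A) i
      ≡⟨ cong (length a +_) eb ⟩
    length a + (length b + cost M U (X ⊹ A ⊹ B) i)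
      ≡⟨ cong (λ k → length a + (length b + k)) ec ⟩
    length a + (length b + (length c + cost M W (X ⊹ A ⊹ B ⊹ C) i))
      ≡⟨ regroup M W X i a b c ⟩
    (length a + (length b + length c)) + cost M W (X ⊹ (A ⊹ (B ⊹ C))) i
      ≡⟨ cong₂ (λ ℓ S → ℓ + cost M W (X ⊹ S) i) (sym (length-joinFactors a b c)) (sym (sumᴾ-joinFactors a b c)) ⟩
    length (joinFactors a b c) + cost M W (X ⊹ sumᴾ (joinFactors a b c)) i ∎)
    where
    open ≡-Reasoning
    U V : Table (suc n) (Costs.A M)
    U = apply (along₀₁ n) M W
    V = apply (along₁ n) M U
    A B C : Ten (suc n)
    A = e₀ ⊗ sumᴾ a
    B = e₁ ⊗ sumᴾ b
    C = e₀₁ ⊗ sumᴾ c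

distance-isDistance : ∀ n → IsDistance sumᴾ (distance n)
distance-isDistance zero = distance-zero
distance-isDistance (suc n) = distance-suc (distance-isDistance n)

-- A cost exceeding every rank that occurs; it stands for "unreachable".
∞ : ℕ
∞ = 50

6<∞ : 6 < ∞
6<∞ = toWitness {a? = 6 <? ∞} tt

isZero : ∀ {n} → Ten n → Bool
isZero {zero} b = not b
isZero {suc n} (x ∷ y ∷ []) = isZero x ∧ isZero y

isZero-0ᵗ : ∀ {n} → isZero (0ᵗ {n}) ≡ true
isZero-0ᵗ {zero} = refl
isZero-0ᵗ {suc n} rewrite isZero-0ᵗ {n} = refl

isZero-sound : ∀ {n} (Y : Ten n) → isZero Y ≡ true → Y ≡ 0ᵗ
isZero-sound {zero} false e = refl
isZero-sound {suc n} (x ∷ y ∷ []) e with isZero x in ex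
... | true = cong₂ pair (isZero-sound x ex) (isZero-sound y e)

originCost : ∀ {n} → Ten n → ℕ
originCost Y = if isZero Y then 0 else ∞

originCost-0ᵗ : ∀ {n} → originCost (0ᵗ {n}) ≡ 0
originCost-0ᵗ {n} = cong (λ b → if b then 0 else ∞) (isZero-0ᵗ {n})

opaque
  origin : Table 3 ℕ
  origin = tableOf 3 originCost

  at-origin : ∀ Y → at 3 origin Y ≡ originCost Y
  at-origin = at-tableOf 3 originCost

opaque
  rank₃Table : Table 3 ℕ
  rank₃Table = apply (distance 3) ℕCosts origin

  rank₃Table-≡ : rank₃Table ≡ apply (distance 3) ℕCosts origin
  rank₃Table-≡ = refl

rank₃ : Ten 3 → ℕ
rank₃ Y = at 3 rank₃Table Y

rank₃-cost : ∀ Y → rank₃ Y ≡ cost ℕCosts (apply (distance 3) ℕCosts origin) Y tt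
rank₃-cost Y = cong (λ t → at 3 t Y) rank₃Table-≡

rank₃-≤ : ∀ (ps : List (Pure 3)) → rank₃ (sumᴾ ps) ≤ length ps
rank₃-≤ ps = begin
  rank₃ S                              ≡⟨ rank₃-cost S ⟩
  cost ℕCosts (apply (distance 3) ℕCosts origin) S tt
                                       ≤⟨ IsDistance.bounded (distance-isDistance 3) ℕCosts origin S tt ps ⟩
  length ps + at 3 origin (S ⊹ S)      ≡⟨ cong (length ps +_) (trans (at-origin (S ⊹ S)) (cong originCost (⊹-self S))) ⟩
  length ps + originCost (0ᵗ {3})      ≡⟨ cong (length ps +_) (originCost-0ᵗ {3}) ⟩
  length ps + 0                        ≡⟨ +-identityʳ (length ps) ⟩
  length ps                            ∎
  where
  open ≤-Reasoning
  S : Ten 3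
  S = sumᴾ ps

rank₃-attained : ∀ Y → rank₃ Y < ∞ → Σ (List (Pure 3)) λ ps → length ps ≡ rank₃ Y × sumᴾ ps ≡ Y
rank₃-attained Y r<∞ with IsDistance.attained (distance-isDistance 3) ℕCosts origin Y tt
... | ps , e = ps , realised (trans (rank₃-cost Y) (trans e (cong (length ps +_) (at-origin (Y ⊹ sumᴾ ps)))))
  where
  realised : rank₃ Y ≡ length ps + (if isZero (Y ⊹ sumᴾ ps) then 0 else ∞) → length ps ≡ rank₃ Y × sumᴾ ps ≡ Y
  realised r with isZero (Y ⊹ sumᴾ ps) in z
  ... | true = sym (trans r (+-identityʳ _)) , ⊹-zero⇒≡ Y (sumᴾ ps) (isZero-sound _ z)
  ... | false = ⊥-elim (<⇒≱ r<∞ (subst (∞ ≤_) (sym r) (m≤n+m ∞ (length ps))))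

-- Once the e₀-part of a decomposition of an order-4 tensor is fixed, the rest reads
-- e₁ ⊗ B ⊹ e₀₁ ⊗ C = pair C (B ⊹ C); its cheapest cost at pair Y Z is rank₃ Y + rank₃ (Y ⊹ Z).
-- (The table r is a parameter so that its evaluation is shared by all rows.)
pairTableOf : Table 3 ℕ → Table 4 ℕ
pairTableOf r = zipᵀ 3 (λ a u → mapᵀ 3 (a +_) u) r (tableOf 3 (λ Y → translate 3 Y r))

opaque
  pairTable : Table 4 ℕ
  pairTable = pairTableOf rank₃Table

  at-pairTable : ∀ Y Z → at 4 pairTable (pair Y Z) ≡ rank₃ Y + rank₃ (Y ⊹ Z)
  at-pairTable Y Z = begin
    at 3 (at 3 pairTable Y) Z
      ≡⟨ cong (λ w → at 3 w Z) (at-zipᵀ 3 (λ a u → mapᵀ 3 (a +_) u) rank₃Table (tableOf 3 (λ Y → translate 3 Y rank₃Table)) Y) ⟩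
    at 3 (mapᵀ 3 (rank₃ Y +_) (at 3 (tableOf 3 (λ Y → translate 3 Y rank₃Table)) Y)) Z
      ≡⟨ at-mapᵀ 3 (rank₃ Y +_) _ Z ⟩
    rank₃ Y + at 3 (at 3 (tableOf 3 (λ Y → translate 3 Y rank₃Table)) Y) Z
      ≡⟨ cong (λ w → rank₃ Y + at 3 w Z) (at-tableOf 3 (λ Y → translate 3 Y rank₃Table) Y) ⟩
    rank₃ Y + at 3 (translate 3 Y rank₃Table) Z
      ≡⟨ cong (rank₃ Y +_) (at-translate 3 Y rank₃Table Z) ⟩
    rank₃ Y + rank₃ (Y ⊹ Z) ∎
    where open ≡-Reasoning

opaque
  rank₄Table : Table 4 ℕ
  rank₄Table = apply (along₀ 3) ℕCosts pairTable

  rank₄Table-≡ : rank₄Table ≡ apply (along₀ 3) ℕCosts pairTable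
  rank₄Table-≡ = refl

rank₄ : Tensor → ℕ
rank₄ X = at 4 rank₄Table X

rank₄-cost : ∀ X → rank₄ X ≡ cost ℕCosts (apply (along₀ 3) ℕCosts pairTable) X tt
rank₄-cost X = cong (λ t → at 4 t X) rank₄Table-≡

along₀-3 : IsDistance (λ ps → e₀ ⊗ sumᴾ ps) (along₀ 3)
along₀-3 = along₀-isDistance (distance-isDistance 3)

rank₄-≤ : ∀ (ps : List (Pure 4)) → rank₄ (sumᴾ ps) ≤ length ps
rank₄-≤ ps with byFirstFactor ps
... | sorted a b c l s = begin
  rank₄ S
    ≡⟨ rank₄-cost S ⟩
  cost ℕCosts (apply (along₀ 3) ℕCosts pairTable) S tt
    ≤⟨ IsDistance.bounded along₀-3 ℕCosts pairTable S tt a ⟩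
  length a + at 4 pairTable (S ⊹ e₀ ⊗ A)
    ≡⟨ cong (λ X → length a + at 4 pairTable X) rest ⟩
  length a + at 4 pairTable (pair C (B ⊹ C))
    ≡⟨ cong (length a +_) (at-pairTable C (B ⊹ C)) ⟩
  length a + (rank₃ C + rank₃ (C ⊹ (B ⊹ C)))
    ≡⟨ cong (λ Y → length a + (rank₃ C + rank₃ Y)) (⊹-cancel-outer C B) ⟩
  length a + (rank₃ C + rank₃ B)
    ≤⟨ +-monoʳ-≤ (length a) (+-mono-≤ (rank₃-≤ c) (rank₃-≤ b)) ⟩
  length a + (length c + length b)
    ≡⟨ cong (length a +_) (+-comm (length c) (length b)) ⟩
  length a + (length b + length c)
    ≡⟨ sym l ⟩
  length ps ∎
  where
  open ≤-Reasoning
  S : Tensor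
  S = sumᴾ ps
  A B C : Ten 3
  A = sumᴾ a
  B = sumᴾ b
  C = sumᴾ c
  rest : S ⊹ e₀ ⊗ A ≡ pair C (B ⊹ C)
  rest = trans (cong (_⊹ e₀ ⊗ A) s) (trans (⊹-cancel-wrap (e₀ ⊗ A) _) (cong (λ Y → pair Y (B ⊹ C)) (⊹-identityˡ C)))

rank₄-via : ∀ X0 X1 → Σ (List (Pure 3)) λ a →
  rank₄ (pair X0 X1) ≡ length a + (rank₃ (X0 ⊹ sumᴾ a) + rank₃ ((X0 ⊹ sumᴾ a) ⊹ X1))
rank₄-via X0 X1 = a , trans (rank₄-cost (pair X0 X1)) (trans e (cong (length a +_)
  (trans (at-pairTable Y (X1 ⊹ 0ᵗ)) (cong (λ Z → rank₃ Y + rank₃ (Y ⊹ Z)) (⊹-identityʳ X1)))))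
  where
  optimal : Σ (List (Pure 3)) λ a → cost ℕCosts (apply (along₀ 3) ℕCosts pairTable) (pair X0 X1) tt
    ≡ length a + cost ℕCosts pairTable (pair X0 X1 ⊹ e₀ ⊗ sumᴾ a) tt
  optimal = IsDistance.attained along₀-3 ℕCosts pairTable (pair X0 X1) tt
  a : List (Pure 3)
  a = proj₁ optimal
  e : cost ℕCosts (apply (along₀ 3) ℕCosts pairTable) (pair X0 X1) tt
    ≡ length a + cost ℕCosts pairTable (pair X0 X1 ⊹ e₀ ⊗ sumᴾ a) tt
  e = proj₂ optimal
  Y : Ten 3
  Y = X0 ⊹ sumᴾ a

rank₄-attained : ∀ X → rank₄ X ≤ 6 → Σ (List (Pure 4)) λ ps → length ps ≡ rank₄ X × sumᴾ ps ≡ X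
rank₄-attained (X0 ∷ X1 ∷ []) r≤6 = joinFactors a b c , length-≡ , sum-≡
  where
  via : Σ (List (Pure 3)) λ a →
    rank₄ (pair X0 X1) ≡ length a + (rank₃ (X0 ⊹ sumᴾ a) + rank₃ ((X0 ⊹ sumᴾ a) ⊹ X1))
  via = rank₄-via X0 X1
  a : List (Pure 3)
  a = proj₁ via
  Y : Ten 3
  Y = X0 ⊹ sumᴾ a
  r : rank₄ (pair X0 X1) ≡ length a + (rank₃ Y + rank₃ (Y ⊹ X1))
  r = proj₂ via
  below : ∀ {k} → k ≤ rank₃ Y + rank₃ (Y ⊹ X1) → k < ∞
  below k≤ = ≤-<-trans (≤-trans k≤ (≤-trans (m≤n+m _ (length a)) (≤-trans (≤-reflexive (sym r)) r≤6))) 6<∞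
  part₀₁ : Σ (List (Pure 3)) λ c → length c ≡ rank₃ Y × sumᴾ c ≡ Y
  part₀₁ = rank₃-attained Y (below (m≤m+n (rank₃ Y) (rank₃ (Y ⊹ X1))))
  part₁ : Σ (List (Pure 3)) λ b → length b ≡ rank₃ (Y ⊹ X1) × sumᴾ b ≡ Y ⊹ X1
  part₁ = rank₃-attained (Y ⊹ X1) (below (m≤n+m (rank₃ (Y ⊹ X1)) (rank₃ Y)))
  b c : List (Pure 3)
  b = proj₁ part₁
  c = proj₁ part₀₁
  length-≡ : length (joinFactors a b c) ≡ rank₄ (pair X0 X1)
  length-≡ = begin
    length (joinFactors a b c)            ≡⟨ length-joinFactors a b c ⟩
    length a + (length b + length c)      ≡⟨ cong (length a +_) (cong₂ _+_ (proj₁ (proj₂ part₁)) (proj₁ (proj₂ part₀₁))) ⟩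
    length a + (rank₃ (Y ⊹ X1) + rank₃ Y) ≡⟨ cong (length a +_) (+-comm (rank₃ (Y ⊹ X1)) (rank₃ Y)) ⟩
    length a + (rank₃ Y + rank₃ (Y ⊹ X1)) ≡⟨ sym r ⟩
    rank₄ (pair X0 X1)                    ∎
    where open ≡-Reasoning
  sum-≡ : sumᴾ (joinFactors a b c) ≡ pair X0 X1
  sum-≡ = trans (sumᴾ-joinFactors a b c) (cong₂ pair
    (trans (cong (λ C → sumᴾ a ⊹ (0ᵗ ⊹ C)) (proj₂ (proj₂ part₀₁)))
      (trans (cong (sumᴾ a ⊹_) (⊹-identityˡ Y)) (⊹-cancel-outer (sumᴾ a) X0)))
    (trans (⊹-identityˡ _) (trans (cong₂ _⊹_ (proj₂ (proj₂ part₁)) (proj₂ (proj₂ part₀₁))) (⊹-cancel-wrap Y X1))))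

vec : Dir → Vec2
vec e₀ = true ∷ false ∷ []
vec e₁ = false ∷ true ∷ []
vec e₀₁ = true ∷ true ∷ []

vec-nonZero : ∀ d → NonZero2 (vec d)
vec-nonZero e₀ allZero with allZero zero
... | ()
vec-nonZero e₁ allZero with allZero (suc zero)
... | ()
vec-nonZero e₀₁ allZero with allZero zero
... | ()

dir : (v : Vec2) → NonZero2 v → Dir
dir (true ∷ false ∷ []) _ = e₀
dir (false ∷ true ∷ []) _ = e₁
dir (true ∷ true ∷ []) _ = e₀₁
dir (false ∷ false ∷ []) nz = ⊥-elim (nz λ { zero → refl ; (suc zero) → refl })

vec-dir : ∀ v nz → vec (dir v nz) ≡ v
vec-dir (true ∷ false ∷ []) _ = refl
vec-dir (false ∷ true ∷ []) _ = refl
vec-dir (true ∷ true ∷ []) _ = refl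
vec-dir (false ∷ false ∷ []) nz = ⊥-elim (nz λ { zero → refl ; (suc zero) → refl })

fromPure : Pure 4 → RankOne
fromPure (a , b , c , d , tt) = r1 (vec a) (vec b) (vec c) (vec d) (vec-nonZero a) (vec-nonZero b) (vec-nonZero c) (vec-nonZero d)

toPure : RankOne → Pure 4
toPure (r1 a b c d p q r s) = dir a p , dir b q , dir c r , dir d s , tt

-- Boolean functions of n indices in Fin 2, the form in which Defs builds tensors.
Entries : ℕ → Set
Entries zero = Bool
Entries (suc n) = Fin 2 → Entries n

fromEntries : ∀ n → Entries n → Ten n
fromEntries zero b = b
fromEntries (suc n) f = tabulate λ i → fromEntries n (f i)

scale : ∀ n → Bool → Entries n → Entries n
scale zero s b = s ∧ b
scale (suc n) s f i = scale n s (f i)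

fromEntries-scale-true : ∀ n f → fromEntries n (scale n true f) ≡ fromEntries n f
fromEntries-scale-true zero b = refl
fromEntries-scale-true (suc n) f = cong₂ pair (fromEntries-scale-true n (f zero)) (fromEntries-scale-true n (f (suc zero)))

fromEntries-scale-false : ∀ n f → fromEntries n (scale n false f) ≡ 0ᵗ
fromEntries-scale-false zero b = refl
fromEntries-scale-false (suc n) f = cong₂ pair (fromEntries-scale-false n (f zero)) (fromEntries-scale-false n (f (suc zero)))

entriesᴾ : ∀ {n} → Pure (suc n) → Entries (suc n)
entriesᴾ {zero} (d , tt) = lookup (vec d)
entriesᴾ {suc n} (d , p) i = scale (suc n) (lookup (vec d) i) (entriesᴾ p)

fromEntries-entriesᴾ : ∀ {n} (p : Pure (suc n)) → fromEntries (suc n) (entriesᴾ p) ≡ ⟦ p ⟧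
fromEntries-entriesᴾ {zero} (e₀ , tt) = refl
fromEntries-entriesᴾ {zero} (e₁ , tt) = refl
fromEntries-entriesᴾ {zero} (e₀₁ , tt) = refl
fromEntries-entriesᴾ {suc n} (d , p) = trans (outer-vec d) (cong (d ⊗_) (fromEntries-entriesᴾ p))
  where
  outer-vec : ∀ d → fromEntries (suc (suc n)) (entriesᴾ (d , p)) ≡ d ⊗ fromEntries (suc n) (entriesᴾ p)
  outer-vec e₀ = cong₂ pair (fromEntries-scale-true (suc n) (entriesᴾ p)) (fromEntries-scale-false (suc n) (entriesᴾ p))
  outer-vec e₁ = cong₂ pair (fromEntries-scale-false (suc n) (entriesᴾ p)) (fromEntries-scale-true (suc n) (entriesᴾ p))
  outer-vec e₀₁ = cong₂ pair (fromEntries-scale-true (suc n) (entriesᴾ p)) (fromEntries-scale-true (suc n) (entriesᴾ p))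

outer-fromPure : ∀ p → outer (fromPure p) ≡ ⟦ p ⟧
outer-fromPure p@(a , b , c , d , tt) = fromEntries-entriesᴾ p

outer-cong : ∀ t t′ → RankOne.v₁ t ≡ RankOne.v₁ t′ → RankOne.v₂ t ≡ RankOne.v₂ t′ →
  RankOne.v₃ t ≡ RankOne.v₃ t′ → RankOne.v₄ t ≡ RankOne.v₄ t′ → outer t ≡ outer t′
outer-cong (r1 a b c d _ _ _ _) (r1 .a .b .c .d _ _ _ _) refl refl refl refl = refl

outer-toPure : ∀ t → outer t ≡ ⟦ toPure t ⟧
outer-toPure t@(r1 a b c d p q r s) =
  trans (outer-cong t (fromPure (toPure t)) (sym (vec-dir a p)) (sym (vec-dir b q)) (sym (vec-dir c r)) (sym (vec-dir d s)))
    (outer-fromPure (toPure t))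

xorEntries : ∀ n → Ten n → Ten n → Entries n
xorEntries zero a b = a xor b
xorEntries (suc n) X Y i = xorEntries n (lookup X i) (lookup Y i)

fromEntries-xor : ∀ n (X Y : Ten n) → fromEntries n (xorEntries n X Y) ≡ X ⊹ Y
fromEntries-xor zero a b = refl
fromEntries-xor (suc n) (a ∷ b ∷ []) (c ∷ d ∷ []) = cong₂ pair (fromEntries-xor n a c) (fromEntries-xor n b d)

⊕≡⊹ : ∀ (X Y : Tensor) → X ⊕ Y ≡ X ⊹ Y
⊕≡⊹ = fromEntries-xor 4

sumT-toPure : ∀ ts → sumT ts ≡ sumᴾ (map toPure ts)
sumT-toPure [] = refl
sumT-toPure (t ∷ ts) = trans (⊕≡⊹ (outer t) (sumT ts)) (cong₂ _⊹_ (outer-toPure t) (sumT-toPure ts))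

sumT-fromPure : ∀ ps → sumT (map fromPure ps) ≡ sumᴾ ps
sumT-fromPure [] = refl
sumT-fromPure (p ∷ ps) = trans (⊕≡⊹ (outer (fromPure p)) (sumT (map fromPure ps))) (cong₂ _⊹_ (outer-fromPure p) (sumT-fromPure ps))

rank₄-lower : ∀ X R → HasDecomp X R → rank₄ X ≤ R
rank₄-lower X R (ts , l , s) = subst₂ (λ Y k → rank₄ Y ≤ k)
  (trans (sym (sumT-toPure ts)) s) (trans (length-map toPure ts) l) (rank₄-≤ (map toPure ts))

rank₄-decomposition : ∀ X → rank₄ X ≤ 6 → HasDecomp X (rank₄ X)
rank₄-decomposition X r≤6 with rank₄-attained X r≤6
... | ps , l , s = map fromPure ps , trans (length-map fromPure ps) l , trans (sumT-fromPure ps) s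

isRank⇔ : ∀ X R → rank₄ X ≤ 6 → IsRank X R ⇔ rank₄ X ≡ R
isRank⇔ X R r≤6 = mk⇔
  (λ (h , minimal) → ≤-antisym (rank₄-lower X R h) (≮⇒≥ λ r<R → minimal (rank₄ X) r<R (rank₄-decomposition X r≤6)))
  (λ { refl → rank₄-decomposition X r≤6 , λ S S<r h → <⇒≱ S<r (rank₄-lower X S h) })

sumᵀ : ∀ n {A : Set} → (A → ℕ) → Table n A → ℕ
sumᵀ zero f (a & b) = f a + f b
sumᵀ (suc n) f t = sumᵀ n (sumᵀ n f) t

sum-cartesianProductWith : ∀ {A B C : Set} (f : A → B → C) (g : C → ℕ) xs ys →
  sum (map g (cartesianProductWith f xs ys)) ≡ sum (map (λ x → sum (map (λ y → g (f x y)) ys)) xs)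
sum-cartesianProductWith f g [] ys = refl
sum-cartesianProductWith f g (x ∷ xs) ys = begin
  sum (map g (map (f x) ys ++ cartesianProductWith f xs ys))
    ≡⟨ cong sum (map-++ g (map (f x) ys) _) ⟩
  sum (map g (map (f x) ys) ++ map g (cartesianProductWith f xs ys))
    ≡⟨ sum-++ (map g (map (f x) ys)) _ ⟩
  sum (map g (map (f x) ys)) + sum (map g (cartesianProductWith f xs ys))
    ≡⟨ cong₂ _+_ (cong sum (sym (map-∘ ys))) (sum-cartesianProductWith f g xs ys) ⟩
  sum (map (λ y → g (f x y)) ys) + sum (map (λ x → sum (map (λ y → g (f x y)) ys)) xs) ∎
  where open ≡-Reasoning

opaque
  allTen : ∀ n → List (Ten n)
  allTen zero = false ∷ true ∷ []
  allTen (suc n) = cartesianProductWith pair (allTen n) (allTen n)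

  allTen-unique : ∀ n → Unique (allTen n)
  allTen-unique zero = ((λ ()) ∷ []) ∷ ([] ∷ [])
  allTen-unique (suc n) = cartesianProductWith⁺ pair pair-injective (allTen-unique n) (allTen-unique n)
    where
    pair-injective : ∀ {w x y z : Ten n} → pair w y ≡ pair x z → w ≡ x × y ≡ z
    pair-injective refl = refl , refl

  allTen-complete : ∀ n (X : Ten n) → X ∈ allTen n
  allTen-complete zero false = here refl
  allTen-complete zero true = there (here refl)
  allTen-complete (suc n) (x ∷ y ∷ []) = ∈-cartesianProductWith⁺ pair (allTen-complete n x) (allTen-complete n y)

  sum-allTen : ∀ n {A : Set} (f : A → ℕ) t → sum (map (λ X → f (at n t X)) (allTen n)) ≡ sumᵀ n f t
  sum-allTen zero f (a & b) = cong (f a +_) (+-identityʳ (f b))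
  sum-allTen (suc n) f t = trans (sum-cartesianProductWith pair (λ X → f (at (suc n) t X)) (allTen n) (allTen n))
    (trans (cong sum (map-cong (λ x → sum-allTen n f (at n t x)) (allTen n))) (sum-allTen n (sumᵀ n f) t))

sumᵀ-zero : ∀ n {A : Set} (f : A → ℕ) t → sumᵀ n f t ≡ 0 → ∀ X → f (at n t X) ≡ 0
sumᵀ-zero zero f (a & b) e false = m+n≡0⇒m≡0 (f a) e
sumᵀ-zero zero f (a & b) e true = m+n≡0⇒n≡0 (f a) e
sumᵀ-zero (suc n) f t e (x ∷ y ∷ []) = sumᵀ-zero n f (at n t x) (sumᵀ-zero n (sumᵀ n f) t e x) y

indicator : Bool → ℕ
indicator true = 1
indicator false = 0

length-filter-≡ : ∀ {A : Set} {P : A → Set} (P? : (x : A) → Dec (P x)) xs →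
  length (filter P? xs) ≡ sum (map (λ x → indicator (does (P? x))) xs)
length-filter-≡ P? [] = refl
length-filter-≡ P? (x ∷ xs) with does (P? x)
... | true = cong suc (length-filter-≡ P? xs)
... | false = length-filter-≡ P? xs

count : ℕ → Table 4 ℕ → ℕ
count k t = sumᵀ 4 (λ v → indicator (does (v ≟ k))) t

countAbove6 : Table 4 ℕ → ℕ
countAbove6 t = sumᵀ 4 (λ v → indicator (7 ≤ᵇ v)) t

rankCounts : Vec ℕ 7
rankCounts = 1 ∷ 81 ∷ 2268 ∷ 21744 ∷ 37530 ∷ 3888 ∷ 24 ∷ []

census : Table 4 ℕ → Vec ℕ 8
census t = countAbove6 t ∷ tabulate (λ (r : Fin 7) → count (toℕ r) t)

-- Boolean equality of vectors of naturals, for deciding equalities by evaluation.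
sameEntries : ∀ {n} → Vec ℕ n → Vec ℕ n → Bool
sameEntries [] [] = true
sameEntries (x ∷ xs) (y ∷ ys) = (x ≡ᵇ y) ∧ sameEntries xs ys

sameEntries-sound : ∀ {n} (u v : Vec ℕ n) → T (sameEntries u v) → u ≡ v
sameEntries-sound [] [] _ = refl
sameEntries-sound (x ∷ xs) (y ∷ ys) same = cong₂ _∷_ (≡ᵇ⇒≡ x y (proj₁ both)) (sameEntries-sound xs ys (proj₂ both))
  where
  both : T (x ≡ᵇ y) × T (sameEntries xs ys)
  both = Equivalence.to T-∧ same

-- The census of the rank table, obtained by evaluating it.  (The comparison is a single
-- Boolean, which the type checker evaluates with sharing of the table.)
opaque
  unfolding rank₄Table pairTable rank₃Table origin
  census-matches : sameEntries (census rank₄Table) (0 ∷ rankCounts) ≡ true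
  census-matches = refl

census-rank₄Table : census rank₄Table ≡ 0 ∷ rankCounts
census-rank₄Table = sameEntries-sound (census rank₄Table) (0 ∷ rankCounts) (Equivalence.from T-≡ census-matches)

indicator-zero : ∀ {b} → indicator b ≡ 0 → ¬ T b
indicator-zero {false} _ ()
indicator-zero {true} ()

rank₄-≤6 : ∀ X → rank₄ X ≤ 6
rank₄-≤6 X = ≤-pred (≰⇒> λ 7≤r →
  indicator-zero (sumᵀ-zero 4 (λ v → indicator (7 ≤ᵇ v)) rank₄Table (cong head census-rank₄Table) X) (≤⇒≤ᵇ 7≤r))

ofRank : ℕ → List Tensor
ofRank k = filter (λ X → rank₄ X ≟ k) (allTen 4)

ofRank-∈ : ∀ k X → (X ∈ ofRank k) ⇔ IsRank X k
ofRank-∈ k X = mk⇔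
  (λ X∈ → Equivalence.from (isRank⇔ X k (rank₄-≤6 X)) (proj₂ (∈-filter⁻ (λ X → rank₄ X ≟ k) {xs = allTen 4} X∈)))
  (λ isRank → ∈-filter⁺ (λ X → rank₄ X ≟ k) (allTen-complete 4 X) (Equivalence.to (isRank⇔ X k (rank₄-≤6 X)) isRank))

length-ofRank : (r : Fin 7) → length (ofRank (toℕ r)) ≡ lookup rankCounts r
length-ofRank r = begin
  length (ofRank (toℕ r))
    ≡⟨ length-filter-≡ (λ X → rank₄ X ≟ toℕ r) (allTen 4) ⟩
  sum (map (λ X → indicator (does (rank₄ X ≟ toℕ r))) (allTen 4))
    ≡⟨ sum-allTen 4 (λ v → indicator (does (v ≟ toℕ r))) rank₄Table ⟩
  count (toℕ r) rank₄Table
    ≡⟨ sym (lookup∘tabulate (λ r → count (toℕ r) rank₄Table) r) ⟩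
  lookup (tabulate (λ r → count (toℕ r) rank₄Table)) r
    ≡⟨ cong (λ counts → lookup counts (suc r)) census-rank₄Table ⟩
  lookup rankCounts r ∎
  where open ≡-Reasoning

member : ∀ {A : Set} (xs : List A) {k} → length xs ≡ suc k → Σ A (_∈ xs)
member (x ∷ xs) _ = x , here refl

mainTheorem5 : ((X : Tensor) → Σ ℕ λ R → (R ≤ 6) × IsRank X R)
    × (Σ Tensor λ X → IsRank X 6)
    × ((r : Fin 7) → Σ (List Tensor) λ L → Unique L
        × (∀ X → (X ∈ L) ⇔ IsRank X (toℕ r))
        × (length L ≡ lookup (1 ∷ 81 ∷ 2268 ∷ 21744 ∷ 37530 ∷ 3888 ∷ 24 ∷ []) r))
mainTheorem5 = everyRank , rankSix , λ r → ofRank (toℕ r) , filter⁺ (λ X → rank₄ X ≟ toℕ r) (allTen-unique 4)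
                                         , ofRank-∈ (toℕ r) , length-ofRank r
  where
  everyRank : (X : Tensor) → Σ ℕ λ R → (R ≤ 6) × IsRank X R
  everyRank X = rank₄ X , rank₄-≤6 X , Equivalence.from (isRank⇔ X (rank₄ X) (rank₄-≤6 X)) refl
  rankSix : Σ Tensor λ X → IsRank X 6
  rankSix with member (ofRank 6) (length-ofRank (suc (suc (suc (suc (suc (suc zero)))))))
  ... | X , X∈ = X , Equivalence.to (ofRank-∈ 6 X) X∈
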